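{- Let $P$ be a finite poset having a minimum $\hat0$ and a maximum $\hat1$, and fix an order ideal $I$ of $P$ with $I\ne\emptyset$ and $I\ne P$. Then $|\mathcal{L}(P)|=\sum_{L\in\mathcal{L}(P)}|{\sf des}_I(L)|$.
   Context: Let $n=|P|$. $\mathcal{L}(P)$ is the set of linear extensions of $P$, i.e. bijections $L:P\to\{1,\ldots,n\}$ with $L(p)<L(q)$ whenever $p<q$. An order ideal is a downward-closed subset of $P$. For $L\in\mathcal{L}(P)$, ${\sf des}_I(L)$ is the set of $p\in I$ with $L(p)<n$ such that $q=L^{ -1}(L(p)+1)$ satisfies $q\notin I$ and $q$ covers $p$. -}

module Defs where

open import Data.Nat as ℕ using (ℕ; suc)
open import Data.Fin using (Fin; toℕ)
open import Data.Fin.Properties using (any?)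
open import Data.Fin.Subset using (Subset; _∈_; _∉_)
open import Data.Fin.Subset.Properties using (_∈?_)
open import Data.Vec using (Vec; lookup)
open import Data.List using (List; length; filter; map; allFin)
open import Data.Product using (Σ; ∃; _×_; _,_)
open import Function.Definitions using (Injective)
open import Relation.Nullary using (¬_; Dec; yes; no)
open import Relation.Nullary.Decidable using (_×-dec_; ¬?)
open import Relation.Binary.PropositionalEquality using (_≡_)
open import Relation.Binary.Structures using (IsDecPartialOrder)
open import Data.Nat.Properties using () renaming (_≟_ to _≟ℕ_)

-- A finite poset P with n elements is modelled as the carrier Fin n with a
-- decidable partial order _≼_ (w.r.t. propositional equality).
module _ {n : ℕ} {_≼_ : Fin n → Fin n → Set}
         (po : IsDecPartialOrder _≡_ _≼_) where

  open IsDecPartialOrder po using (_≟_; _≤?_)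

  _≺_ : Fin n → Fin n → Set
  p ≺ q = (p ≼ q) × ¬ (p ≡ q)

  _≺?_ : ∀ p q → Dec (p ≺ q)
  p ≺? q = (p ≤? q) ×-dec ¬? (p ≟ q)

  Covers : Fin n → Fin n → Set
  Covers q p = (p ≺ q) × ¬ (∃ λ r → (p ≺ r) × (r ≺ q))

  covers? : ∀ q p → Dec (Covers q p)
  covers? q p = (p ≺? q) ×-dec ¬? (any? (λ r → (p ≺? r) ×-dec (r ≺? q)))

  -- A linear extension L : P → {1..n} is represented by the vector of its
  -- values (0-indexed: lookup L p ∈ Fin n stands for L(p) - 1).
  -- Being a bijection Fin n → Fin n is equivalent to being injective.
  IsLinearExtension : Vec (Fin n) n → Set
  IsLinearExtension L =
    Injective _≡_ _≡_ (lookup L) ×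
    (∀ p q → p ≺ q → toℕ (lookup L p) ℕ.< toℕ (lookup L q))

  IsOrderIdeal : Subset n → Set
  IsOrderIdeal I = ∀ p q → q ≼ p → p ∈ I → q ∈ I

  -- p ∈ des_I(L): p ∈ I, L(p) < n, and q = L⁻¹(L(p)+1) satisfies q ∉ I and
  -- q covers p.  (With 0-indexing, L⁻¹(L(p)+1) is the unique q with
  -- toℕ (L q) ≡ suc (toℕ (L p)); such q exists iff L(p) < n.)
  InDes : Subset n → Vec (Fin n) n → Fin n → Set
  InDes I L p =
    (p ∈ I) ×
    (∃ λ q → (toℕ (lookup L q) ≡ suc (toℕ (lookup L p))) × (q ∉ I) × Covers q p)

  inDes? : ∀ I L p → Dec (InDes I L p)
  inDes? I L p =
    (p ∈? I) ×-dec
    any? (λ q → (toℕ (lookup L q) ≟ℕ suc (toℕ (lookup L p)))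
                ×-dec (¬? (q ∈? I)) ×-dec covers? q p)

  desCount : Subset n → Vec (Fin n) n → ℕ
  desCount I L = length (filter (inDes? I L) (allFin n))

module Submission where

-- Read a linear extension L as a word and record, position by position, whether
-- the letter lies in I.  Call p an exit of L if p ∈ I and the next letter is not
-- in I, and q an entry if q ∉ I and the next letter is in I.  Exits are the falls
-- and entries the rises of this 0/1 word; it starts inside I (the minimum comes
-- first) and every letter of I has a successor (it lies below the maximum ∉ I),
-- so telescoping gives #exits(L) = #entries(L) + 1.  Every I-descent is an exit;
-- calling the other exits skips, |des_I(L)| + #skips(L) = #entries(L) + 1.
-- At a skip and at an entry the two adjacent letters are incomparable, so swapping
-- them gives another linear extension; this is an involution exchanging skips and
-- entries over all of L(P), hence Σ #skips = Σ #entries, and summing the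
-- per-extension identity yields the corollary.

open import Defs
open import Data.Nat using (ℕ)
open import Data.Fin using (Fin)
open import Data.Fin.Subset using (Subset; _∈_; _∉_)
open import Data.Vec using (Vec)
open import Data.List using (List; length; map)
open import Data.Nat.ListAction using (sum)
open import Data.List.Relation.Unary.Unique.Propositional using (Unique)
open import Data.Product using (∃; _×_)
open import Function.Bundles using (_⇔_)
open import Relation.Binary.PropositionalEquality using (_≡_)
open import Relation.Binary.Structures using (IsDecPartialOrder)
import Data.List.Membership.Propositional as M

open import Data.Nat using (zero; suc; _+_; _<_; _≤_; z≤n; s≤s; s≤s⁻¹)
open import Data.Nat.Properties
  using (+-assoc; +-comm; +-identityʳ; +-cancelˡ-≡; +-commutativeSemigroup; +-0-commutativeMonoid;
         n<1+n; n≮0; <-irrefl; <-trans; <-asym; ≤∧≢⇒<; ≤-<-trans; <-≤-trans; ≤-antisym)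
  renaming (_≟_ to _≟ℕ_)
open import Data.Bool using (Bool; true; false; _∧_; not)
open import Data.Maybe using (Maybe; just; nothing; maybe′)
open import Data.Fin as Fin using (toℕ; fromℕ<)
open import Data.Fin.Properties
  using (any?; punchOut-injective; pigeonhole; toℕ-injective; toℕ<n; toℕ-fromℕ<)
  renaming (_≟_ to _≟ᶠ_)
open import Data.Fin.Permutation using (permutation)
open import Data.Fin.Permutation.Components using (transpose; transpose-inverse)
open import Data.Fin.Subset.Properties using (_∈?_)
open import Data.Vec using (lookup; tabulate)
open import Data.Vec.Properties using (lookup∘tabulate; tabulate-cong; tabulate∘lookup)
open import Data.List as List using ([]; _∷_; filter; allFin; cartesianProduct)
open import Data.List.Properties using (length-++; filter-++)
open import Data.List.Membership.Propositional.Properties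
  using (∈-filter⁻; ∈-filter⁺; ∈-cartesianProduct⁻; ∈-cartesianProduct⁺; ∈-allFin)
open import Data.List.Relation.Unary.All as All using ()
open import Data.List.Relation.Unary.AllPairs using (_∷_)
open import Data.List.Relation.Unary.Any using (here; there)
open import Data.List.Relation.Unary.Unique.Propositional.Properties using (filter⁺; cartesianProduct⁺; allFin⁺)
open import Data.Product using (_,_; proj₁; proj₂; uncurry)
open import Data.Sum using (_⊎_; inj₁; inj₂)
open import Data.Empty using (⊥-elim)
open import Function using (_∘_; id)
open import Function.Bundles using (mk⇔; Equivalence)
open import Function.Definitions using (Injective)
open import Level using (0ℓ)
open import Relation.Nullary using (¬_; Dec; yes; no; does)
open import Relation.Nullary.Decidable using (_×-dec_; ¬?; dec-true; dec-false; does-⇔)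
open import Relation.Unary using (Pred; Decidable)
open import Relation.Binary.PropositionalEquality using (_≢_; refl; sym; trans; cong; cong₂; subst; subst₂; module ≡-Reasoning)
open import Algebra.Properties.CommutativeMonoid.Sum +-0-commutativeMonoid
  using (sum-syntax; sum-permute; sum-cong-≗; ∑-distrib-+)
import Algebra.Properties.CommutativeSemigroup +-commutativeSemigroup as +-CS

open ≡-Reasoning

𝟙 : Bool → ℕ
𝟙 true  = 1
𝟙 false = 0

#_ : ∀ {n} {P : Pred (Fin n) 0ℓ} → Decidable P → ℕ
#_ {n} P? = length (filter P? (allFin n))

length-filter-tabulate : ∀ {A : Set} {P : Pred A 0ℓ} (P? : Decidable P) {k} (f : Fin k → A) →
  length (filter P? (List.tabulate f)) ≡ ∑[ i < k ] 𝟙 (does (P? (f i)))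
length-filter-tabulate P? {zero}  f = refl
length-filter-tabulate P? {suc k} f with does (P? (f Fin.zero))
... | true  = cong suc (length-filter-tabulate P? (f ∘ Fin.suc))
... | false = length-filter-tabulate P? (f ∘ Fin.suc)

#-as-sum : ∀ {n} {P : Pred (Fin n) 0ℓ} (P? : Decidable P) → # P? ≡ ∑[ i < n ] 𝟙 (does (P? i))
#-as-sum P? = length-filter-tabulate P? id

injective⇒surjective : ∀ {n} (f : Fin n → Fin n) → Injective _≡_ _≡_ f → ∀ y → ∃ λ x → f x ≡ y
injective⇒surjective {suc m} f inj y with any? (λ x → f x ≟ᶠ y)
... | yes hit = hit
... | no miss with pigeonhole (n<1+n m) (λ x → Fin.punchOut {i = y} {j = f x} (λ y≡fx → miss (x , sym y≡fx)))
...   | i , j , i<j , same = ⊥-elim (<-irrefl (cong toℕ (inj (punchOut-injective {i = y} _ _ same))) i<j)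

∑-reindex : ∀ {n} (f : Fin n → Fin n) → Injective _≡_ _≡_ f → (h : Fin n → ℕ) →
  ∑[ i < n ] h i ≡ ∑[ i < n ] h (f i)
∑-reindex f inj h = sum-permute h (permutation f f⁻¹ (λ y → proj₂ (surj y)) (λ x → inj (proj₂ (surj (f x)))))
  where
    surj : ∀ y → ∃ λ x → f x ≡ y
    surj = injective⇒surjective f inj
    f⁻¹ : Fin _ → Fin _
    f⁻¹ y = proj₁ (surj y)

fall rise : (ℕ → Bool) → ℕ → ℕ
fall b j = 𝟙 (b j ∧ not (b (suc j)))
rise b j = 𝟙 (not (b j) ∧ b (suc j))

fall-rise-step : ∀ x y → 𝟙 (x ∧ not y) + 𝟙 y ≡ 𝟙 (not x ∧ y) + 𝟙 x
fall-rise-step true  true  = refl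
fall-rise-step true  false = refl
fall-rise-step false true  = refl
fall-rise-step false false = refl

telescope : ∀ m (b : ℕ → Bool) →
  ∑[ j < m ] fall b (toℕ j) + 𝟙 (b m) ≡ ∑[ j < m ] rise b (toℕ j) + 𝟙 (b 0)
telescope zero    b = refl
telescope (suc m) b = begin
  (fall b 0 + F) + 𝟙 (b (suc m))    ≡⟨ +-assoc (fall b 0) F _ ⟩
  fall b 0 + (F + 𝟙 (b (suc m)))    ≡⟨ cong (fall b 0 +_) (telescope m (b ∘ suc)) ⟩
  fall b 0 + (R + 𝟙 (b 1))          ≡⟨ +-CS.x∙yz≈y∙xz (fall b 0) R _ ⟩
  R + (fall b 0 + 𝟙 (b 1))          ≡⟨ cong (R +_) (fall-rise-step (b 0) (b 1)) ⟩
  R + (rise b 0 + 𝟙 (b 0))          ≡⟨ +-CS.x∙yz≈yx∙z R (rise b 0) _ ⟩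
  (rise b 0 + R) + 𝟙 (b 0)          ∎
  where
    F R : ℕ
    F = ∑[ j < m ] fall (b ∘ suc) (toℕ j)
    R = ∑[ j < m ] rise (b ∘ suc) (toℕ j)

split-indicator : ∀ {D E : Set} (D? : Dec D) (E? : Dec E) → (D → E) →
  𝟙 (does D?) + 𝟙 (does (E? ×-dec ¬? D?)) ≡ 𝟙 (does E?)
split-indicator (yes _) (yes _) _   = refl
split-indicator (yes d) (no ¬e) d→e = ⊥-elim (¬e (d→e d))
split-indicator (no _)  (yes _) _   = refl
split-indicator (no _)  (no _)  _   = refl

remove : ∀ {A : Set} (ys : List A) {z : A} → z M.∈ ys → List A
remove (_ ∷ ys) (here _)    = ys
remove (y ∷ ys) (there z∈)  = y ∷ remove ys z∈

length-remove : ∀ {A : Set} (ys : List A) {z : A} (z∈ : z M.∈ ys) → suc (length (remove ys z∈)) ≡ length ys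
length-remove (_ ∷ ys) (here _)   = refl
length-remove (y ∷ ys) (there z∈) = cong suc (length-remove ys z∈)

∈-remove : ∀ {A : Set} (ys : List A) {y z : A} (z∈ : z M.∈ ys) → y M.∈ ys → y ≢ z → y M.∈ remove ys z∈
∈-remove (_ ∷ ys) (here refl) (here refl) y≢z = ⊥-elim (y≢z refl)
∈-remove (_ ∷ ys) (here refl) (there y∈)  _   = y∈
∈-remove (_ ∷ ys) (there z∈)  (here refl) _   = here refl
∈-remove (_ ∷ ys) (there z∈)  (there y∈)  y≢z = there (∈-remove ys z∈ y∈ y≢z)

length-≤-injection : ∀ {A B : Set} (f : A → B) (xs : List A) (ys : List B) → Unique xs →
  (∀ {x} → x M.∈ xs → f x M.∈ ys) →
  (∀ {x y} → x M.∈ xs → y M.∈ xs → f x ≡ f y → x ≡ y) →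
  length xs ≤ length ys
length-≤-injection f []       ys _              _    _   = z≤n
length-≤-injection f (x ∷ xs) ys (x∉xs ∷ uxs) into inj =
  subst (suc (length xs) ≤_) (length-remove ys fx∈)
    (s≤s (length-≤-injection f xs (remove ys fx∈) uxs
      (λ y∈ → ∈-remove ys fx∈ (into (there y∈))
                (λ fy≡fx → All.lookup x∉xs y∈ (sym (inj (there y∈) (here refl) fy≡fx))))
      (λ x∈ y∈ → inj (there x∈) (there y∈))))
  where
    fx∈ : f x M.∈ ys
    fx∈ = into (here refl)

length-≡-involution : ∀ {A : Set} (τ : A → A) (xs ys : List A) → Unique xs → Unique ys →
  (∀ {x} → x M.∈ xs → τ x M.∈ ys × τ (τ x) ≡ x) →
  (∀ {y} → y M.∈ ys → τ y M.∈ xs × τ (τ y) ≡ y) →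
  length xs ≡ length ys
length-≡-involution τ xs ys uxs uys fwd bwd = ≤-antisym
  (length-≤-injection τ xs ys uxs (proj₁ ∘ fwd) (cancel fwd))
  (length-≤-injection τ ys xs uys (proj₁ ∘ bwd) (cancel bwd))
  where
    cancel : ∀ {zs ws : List _} → (∀ {z} → z M.∈ zs → τ z M.∈ ws × τ (τ z) ≡ z) →
             ∀ {x y} → x M.∈ zs → y M.∈ zs → τ x ≡ τ y → x ≡ y
    cancel back x∈ y∈ τx≡τy = trans (sym (proj₂ (back x∈))) (trans (cong τ τx≡τy) (proj₂ (back y∈)))

length-filter-product : ∀ {A B : Set} {P : A → B → Set} (P? : ∀ a b → Dec (P a b)) (xs : List A) (ys : List B) →
  length (filter (uncurry P?) (cartesianProduct xs ys)) ≡ sum (map (λ a → length (filter (P? a) ys)) xs)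
length-filter-product P? [] ys = refl
length-filter-product P? (x ∷ xs) ys = begin
  length (filter (uncurry P?) (map (x ,_) ys List.++ cartesianProduct xs ys))
    ≡⟨ cong length (filter-++ (uncurry P?) (map (x ,_) ys) _) ⟩
  length (filter (uncurry P?) (map (x ,_) ys) List.++ filter (uncurry P?) (cartesianProduct xs ys))
    ≡⟨ length-++ (filter (uncurry P?) (map (x ,_) ys)) ⟩
  length (filter (uncurry P?) (map (x ,_) ys)) + length (filter (uncurry P?) (cartesianProduct xs ys))
    ≡⟨ cong₂ _+_ (row ys) (length-filter-product P? xs ys) ⟩
  length (filter (P? x) ys) + sum (map (λ a → length (filter (P? a) ys)) xs) ∎
  where
    row : ∀ zs → length (filter (uncurry P?) (map (x ,_) zs)) ≡ length (filter (P? x) zs)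
    row [] = refl
    row (z ∷ zs) with does (P? x z)
    ... | true  = cong suc (row zs)
    ... | false = row zs

sum-map-balance : ∀ {A : Set} (f g h : A → ℕ) (xs : List A) → (∀ x → x M.∈ xs → f x + g x ≡ h x + 1) →
  sum (map f xs) + sum (map g xs) ≡ sum (map h xs) + length xs
sum-map-balance f g h [] _ = refl
sum-map-balance f g h (x ∷ xs) eq = begin
  (f x + F) + (g x + G)  ≡⟨ +-CS.interchange (f x) F (g x) G ⟩
  (f x + g x) + (F + G)  ≡⟨ cong₂ _+_ (eq x (here refl)) (sum-map-balance f g h xs (λ y y∈ → eq y (there y∈))) ⟩
  (h x + 1) + (H + length xs)  ≡⟨ +-CS.interchange (h x) 1 H (length xs) ⟩
  (h x + H) + suc (length xs) ∎
  where
    F G H : ℕ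
    F = sum (map f xs)
    G = sum (map g xs)
    H = sum (map h xs)

module LinearExtensions {n : ℕ} {_≼_ : Fin n → Fin n → Set} (po : IsDecPartialOrder _≡_ _≼_) where

  _⊏_ : Fin n → Fin n → Set
  _⊏_ = _≺_ po

  ≼⇒≡⊎⊏ : ∀ {p q} → p ≼ q → p ≡ q ⊎ p ⊏ q
  ≼⇒≡⊎⊏ {p} {q} p≼q with p ≟ᶠ q
  ... | yes p≡q = inj₁ p≡q
  ... | no  p≢q = inj₂ (p≼q , p≢q)

  Ext : Set
  Ext = Vec (Fin n) n

  IsLE : Ext → Set
  IsLE = IsLinearExtension po

  pos : Ext → Fin n → ℕ
  pos L p = toℕ (lookup L p)

  Next : Ext → Fin n → Fin n → Set
  Next L p q = pos L q ≡ suc (pos L p)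

  module Extension (L : Ext) (le : IsLE L) where

    pos-injective : ∀ {p q} → pos L p ≡ pos L q → p ≡ q
    pos-injective = proj₁ le ∘ toℕ-injective

    pos-monotone : ∀ {p q} → p ⊏ q → pos L p < pos L q
    pos-monotone = proj₂ le _ _

    position-taken : ∀ {j} → j < n → ∃ λ r → pos L r ≡ j
    position-taken j<n with injective⇒surjective (lookup L) (proj₁ le) (fromℕ< j<n)
    ... | r , Lr≡j = r , trans (cong toℕ Lr≡j) (toℕ-fromℕ< j<n)

    next-unique : ∀ {p q q′} → Next L p q → Next L p q′ → q ≡ q′
    next-unique nx nx′ = pos-injective (trans nx (sym nx′))

    adjacent-covers : ∀ {p q} → Next L p q → p ⊏ q → Covers po q p
    adjacent-covers {p} {q} nx p⊏q = p⊏q , λ (r , p⊏r , r⊏q) →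
      <-irrefl refl (<-≤-trans (pos-monotone p⊏r) (s≤s⁻¹ (subst (pos L r <_) nx (pos-monotone r⊏q))))

    next-not-below : ∀ {p q} → Next L p q → ¬ q ⊏ p
    next-not-below nx q⊏p = <-asym (pos-monotone q⊏p) (subst (_ <_) (sym nx) (n<1+n _))

  data TransposeView (a c r : Fin n) : Fin n → Set where
    at-a      : r ≡ a → TransposeView a c r c
    at-c      : r ≢ a → r ≡ c → TransposeView a c r a
    elsewhere : r ≢ a → r ≢ c → TransposeView a c r r

  transpose-view : ∀ a c r → TransposeView a c r (transpose a c r)
  transpose-view a c r with r ≟ᶠ a
  ... | yes r≡a = at-a r≡a
  ... | no  r≢a with r ≟ᶠ c
  ...   | yes r≡c = at-c r≢a r≡c
  ...   | no  r≢c = elsewhere r≢a r≢c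

  transpose-at-a : ∀ a c → transpose a c a ≡ c
  transpose-at-a a c with transpose a c a | transpose-view a c a
  ... | _ | at-a _          = refl
  ... | _ | at-c a≢a _      = ⊥-elim (a≢a refl)
  ... | _ | elsewhere a≢a _ = ⊥-elim (a≢a refl)

  transpose-at-c : ∀ a c → transpose a c c ≡ a
  transpose-at-c a c with transpose a c c | transpose-view a c c
  ... | _ | at-a c≡a        = c≡a
  ... | _ | at-c _ _        = refl
  ... | _ | elsewhere _ c≢c = ⊥-elim (c≢c refl)

  transpose-injective : ∀ (a c : Fin n) → Injective _≡_ _≡_ (transpose a c)
  transpose-injective a c eq =
    trans (sym (transpose-inverse c a)) (trans (cong (transpose c a) eq) (transpose-inverse c a))

  swap : Ext → Fin n → Fin n → Ext
  swap L a c = tabulate (lookup L ∘ transpose a c)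

  lookup-swap : ∀ L a c r → lookup (swap L a c) r ≡ lookup L (transpose a c r)
  lookup-swap L a c = lookup∘tabulate _

  swap-involutive : ∀ L a c → swap (swap L a c) c a ≡ L
  swap-involutive L a c = trans
    (tabulate-cong λ r → trans (lookup-swap L a c _) (cong (lookup L) (transpose-inverse a c)))
    (tabulate∘lookup L)

  module AdjacentSwap (L : Ext) (le : IsLE L) {a c} (nx : Next L a c) (a⋢c : ¬ a ⊏ c) (c⋢a : ¬ c ⊏ a) where
    open Extension L le

    L′ : Ext
    L′ = swap L a c

    pos-swap : ∀ r → pos L′ r ≡ pos L (transpose a c r)
    pos-swap r = cong toℕ (lookup-swap L a c r)

    a<c : pos L a < pos L c
    a<c = subst (pos L a <_) (sym nx) (n<1+n _)

    after-a⇒after-c : ∀ {y} → pos L a < pos L y → y ≢ c → pos L c < pos L y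
    after-a⇒after-c a<y y≢c = ≤∧≢⇒< (subst (_≤ _) (sym nx) a<y) (λ c≡y → y≢c (pos-injective (sym c≡y)))

    before-c⇒before-a : ∀ {x} → pos L x < pos L c → x ≢ a → pos L x < pos L a
    before-c⇒before-a x<c x≢a = ≤∧≢⇒< (s≤s⁻¹ (subst (_ <_) nx x<c)) (x≢a ∘ pos-injective)

    swap-monotone : ∀ x y → x ⊏ y → pos L (transpose a c x) < pos L (transpose a c y)
    swap-monotone x y x⊏y with transpose a c x | transpose-view a c x | transpose a c y | transpose-view a c y
    ... | _ | at-a refl       | _ | at-a refl       = ⊥-elim (proj₂ x⊏y refl)
    ... | _ | at-a refl       | _ | at-c _ refl     = ⊥-elim (a⋢c x⊏y)
    ... | _ | at-a refl       | _ | elsewhere _ y≢c = after-a⇒after-c (pos-monotone x⊏y) y≢c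
    ... | _ | at-c _ refl     | _ | at-a refl       = ⊥-elim (c⋢a x⊏y)
    ... | _ | at-c _ refl     | _ | at-c _ refl     = ⊥-elim (proj₂ x⊏y refl)
    ... | _ | at-c _ refl     | _ | elsewhere _ _   = <-trans a<c (pos-monotone x⊏y)
    ... | _ | elsewhere _ _   | _ | at-a refl       = <-trans (pos-monotone x⊏y) a<c
    ... | _ | elsewhere x≢a _ | _ | at-c _ refl     = before-c⇒before-a (pos-monotone x⊏y) x≢a
    ... | _ | elsewhere _ _   | _ | elsewhere _ _   = pos-monotone x⊏y

    swap-injective : Injective _≡_ _≡_ (lookup L′)
    swap-injective {x} {y} eq =
      transpose-injective a c (proj₁ le (trans (sym (lookup-swap L a c x)) (trans eq (lookup-swap L a c y))))

    swap-linear : IsLE L′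
    swap-linear = swap-injective , λ x y x⊏y →
      subst₂ _<_ (sym (pos-swap x)) (sym (pos-swap y)) (swap-monotone x y x⊏y)

    swap-next : Next L′ c a
    swap-next = begin
      pos L′ a                  ≡⟨ pos-swap a ⟩
      pos L (transpose a c a)   ≡⟨ cong (pos L) (transpose-at-a a c) ⟩
      pos L c                   ≡⟨ nx ⟩
      suc (pos L a)             ≡⟨ cong (suc ∘ pos L) (transpose-at-c a c) ⟨
      suc (pos L (transpose a c c)) ≡⟨ cong suc (pos-swap c) ⟨
      suc (pos L′ c)            ∎

  successor : Ext → Fin n → Maybe (Fin n)
  successor L p with any? (λ q → pos L q ≟ℕ suc (pos L p))
  ... | yes (q , _) = just q
  ... | no _        = nothing

  successor-next : ∀ L → IsLE L → ∀ {p q} → Next L p q → successor L p ≡ just q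
  successor-next L le {p} nx with any? (λ q → pos L q ≟ℕ suc (pos L p))
  ... | yes (q′ , nx′) = cong just (Extension.next-unique L le nx′ nx)
  ... | no none        = ⊥-elim (none (_ , nx))

  exchange : Ext × Fin n → Ext × Fin n
  exchange (L , p) = maybe′ (λ q → swap L p q , q) (L , p) (successor L p)

  exchange-adjacent : ∀ L → IsLE L → ∀ {a c} → Next L a c → ¬ a ⊏ c → ¬ c ⊏ a →
    exchange (L , a) ≡ (swap L a c , c) × IsLE (swap L a c) × Next (swap L a c) c a ×
    exchange (swap L a c , c) ≡ (L , a)
  exchange-adjacent L le {a} {c} nx a⋢c c⋢a =
    cong (maybe′ _ _) (successor-next L le nx) , swap-linear , swap-next ,
    trans (cong (maybe′ _ _) (successor-next _ swap-linear swap-next)) (cong (_, a) (swap-involutive L a c))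
    where open AdjacentSwap L le nx a⋢c c⋢a

  module Ideal (I : Subset n) (ideal : IsOrderIdeal po I) where

    outside-not-below : ∀ {p q} → p ∈ I → q ∉ I → ¬ q ⊏ p
    outside-not-below p∈I q∉I q⊏p = q∉I (ideal _ _ (proj₁ q⊏p) p∈I)

    Exit : Ext → Fin n → Set
    Exit L p = p ∈ I × ∃ λ q → Next L p q × q ∉ I

    exit? : ∀ L p → Dec (Exit L p)
    exit? L p = (p ∈? I) ×-dec any? (λ q → (pos L q ≟ℕ suc (pos L p)) ×-dec ¬? (q ∈? I))

    Entry : Ext → Fin n → Set
    Entry L q = q ∉ I × ∃ λ p → Next L q p × p ∈ I

    entry? : ∀ L q → Dec (Entry L q)
    entry? L q = ¬? (q ∈? I) ×-dec any? (λ p → (pos L p ≟ℕ suc (pos L q)) ×-dec (p ∈? I))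

    Skip : Ext → Fin n → Set
    Skip L p = Exit L p × ¬ InDes po I L p

    skip? : ∀ L p → Dec (Skip L p)
    skip? L p = exit? L p ×-dec ¬? (inDes? po I L p)

    descent⇒exit : ∀ {L p} → InDes po I L p → Exit L p
    descent⇒exit (p∈I , q , nx , q∉I , _) = p∈I , q , nx , q∉I

    descents+skips : ∀ L → desCount po I L + # skip? L ≡ # exit? L
    descents+skips L = begin
      desCount po I L + # skip? L
        ≡⟨ cong₂ _+_ (#-as-sum (inDes? po I L)) (#-as-sum (skip? L)) ⟩
      ∑[ p < n ] 𝟙 (does (inDes? po I L p)) + ∑[ p < n ] 𝟙 (does (skip? L p))
        ≡⟨ ∑-distrib-+ (λ p → 𝟙 (does (inDes? po I L p))) (λ p → 𝟙 (does (skip? L p))) ⟨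
      ∑[ p < n ] (𝟙 (does (inDes? po I L p)) + 𝟙 (does (skip? L p)))
        ≡⟨ sum-cong-≗ (λ p → split-indicator (inDes? po I L p) (exit? L p) (descent⇒exit {L})) ⟩
      ∑[ p < n ] 𝟙 (does (exit? L p))
        ≡⟨ #-as-sum (exit? L) ⟨
      # exit? L ∎

    Occupied : Ext → ℕ → Set
    Occupied L j = ∃ λ r → r ∈ I × pos L r ≡ j

    occupied? : ∀ L j → Dec (Occupied L j)
    occupied? L j = any? (λ r → (r ∈? I) ×-dec (pos L r ≟ℕ j))

    inI : Ext → ℕ → Bool
    inI L j = does (occupied? L j)

    module Bounded (min : ∃ λ z → ∀ p → z ≼ p) (max : ∃ λ o → ∀ p → p ≼ o)
                   (nonempty : ∃ λ p → p ∈ I) (proper : ∃ λ p → p ∉ I)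
                   (L : Ext) (le : IsLE L) where
      open Extension L le

      minimum∈I : proj₁ min ∈ I
      minimum∈I = ideal _ _ (proj₂ min (proj₁ nonempty)) (proj₂ nonempty)

      maximum∉I : proj₁ max ∉ I
      maximum∉I o∈I = proj₂ proper (ideal _ _ (proj₂ max (proj₁ proper)) o∈I)

      minimum-first : pos L (proj₁ min) ≡ 0
      minimum-first with position-taken {0} (≤-<-trans z≤n (toℕ<n (proj₁ min)))
      ... | r , r-first with ≼⇒≡⊎⊏ (proj₂ min r)
      ...   | inj₁ refl = r-first
      ...   | inj₂ z⊏r  = ⊥-elim (n≮0 (subst (_ <_) r-first (pos-monotone z⊏r)))

      -- Every element of I has a successor, since it lies strictly below the maximum.
      successor-exists : ∀ {p} → p ∈ I → ∃ λ q → Next L p q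
      successor-exists {p} p∈I with ≼⇒≡⊎⊏ (proj₂ max p)
      ... | inj₁ refl = ⊥-elim (maximum∉I p∈I)
      ... | inj₂ p⊏o  = position-taken (≤-<-trans (pos-monotone p⊏o) (toℕ<n _))

      exit⇔fall : ∀ {p} → Exit L p ⇔ (Occupied L (pos L p) × ¬ Occupied L (suc (pos L p)))
      exit⇔fall {p} = mk⇔
        (λ (p∈I , q , nx , q∉I) → (p , p∈I , refl) ,
           λ (r , r∈I , r-next) → q∉I (subst (_∈ I) (next-unique r-next nx) r∈I))
        (λ ((r , r∈I , r-at-p) , next-free) →
           let p∈I = subst (_∈ I) (pos-injective r-at-p) r∈I
               q , nx = successor-exists p∈I
           in p∈I , q , nx , λ q∈I → next-free (q , q∈I , nx))

      entry⇔rise : ∀ {q} → Entry L q ⇔ (¬ Occupied L (pos L q) × Occupied L (suc (pos L q)))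
      entry⇔rise {q} = mk⇔
        (λ (q∉I , p , nx , p∈I) → (λ (r , r∈I , r-at-q) → q∉I (subst (_∈ I) (pos-injective r-at-q) r∈I)) ,
           (p , p∈I , nx))
        (λ (q-free , p , p∈I , nx) → (λ q∈I → q-free (q , q∈I , refl)) , p , nx , p∈I)

      count-by-position : ∀ {P : Fin n → Set} (P? : ∀ p → Dec (P p)) (F : ℕ → ℕ) →
        (∀ p → 𝟙 (does (P? p)) ≡ F (pos L p)) → # P? ≡ ∑[ j < n ] F (toℕ j)
      count-by-position P? F P≡F = begin
        # P?                           ≡⟨ #-as-sum P? ⟩
        ∑[ p < n ] 𝟙 (does (P? p))     ≡⟨ sum-cong-≗ P≡F ⟩
        ∑[ p < n ] F (pos L p)         ≡⟨ ∑-reindex (lookup L) (proj₁ le) (F ∘ toℕ) ⟨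
        ∑[ j < n ] F (toℕ j)           ∎

      first-occupied : inI L 0 ≡ true
      first-occupied = dec-true (occupied? L 0) (proj₁ min , minimum∈I , minimum-first)

      end-free : inI L n ≡ false
      end-free = dec-false (occupied? L n) λ (r , _ , r-at-n) → <-irrefl r-at-n (toℕ<n _)

      exit-is-fall : ∀ p → 𝟙 (does (exit? L p)) ≡ fall (inI L) (pos L p)
      exit-is-fall p = cong 𝟙 (does-⇔ exit⇔fall (exit? L p) (occupied? L _ ×-dec ¬? (occupied? L _)))

      entry-is-rise : ∀ q → 𝟙 (does (entry? L q)) ≡ rise (inI L) (pos L q)
      entry-is-rise q = cong 𝟙 (does-⇔ entry⇔rise (entry? L q) (¬? (occupied? L _) ×-dec occupied? L _))

      exits≡entries+1 : # exit? L ≡ # entry? L + 1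
      exits≡entries+1 = begin
        # exit? L               ≡⟨ count-by-position (exit? L) (fall (inI L)) exit-is-fall ⟩
        falls                   ≡⟨ +-identityʳ falls ⟨
        falls + 𝟙 false         ≡⟨ cong (λ b → falls + 𝟙 b) end-free ⟨
        falls + 𝟙 (inI L n)     ≡⟨ telescope n (inI L) ⟩
        rises + 𝟙 (inI L 0)     ≡⟨ cong (λ b → rises + 𝟙 b) first-occupied ⟩
        rises + 1               ≡⟨ cong (_+ 1) (count-by-position (entry? L) (rise (inI L)) entry-is-rise) ⟨
        # entry? L + 1          ∎
        where
          falls rises : ℕ
          falls = ∑[ j < n ] fall (inI L) (toℕ j)
          rises = ∑[ j < n ] rise (inI L) (toℕ j)

      balance : desCount po I L + # skip? L ≡ # entry? L + 1
      balance = trans (descents+skips L) exits≡entries+1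

    Flagged : (Ext → Fin n → Set) → Ext × Fin n → Set
    Flagged P (L , p) = IsLE L × P L p

    -- A skip p → q is a swap of adjacent incomparable elements; exchanging them
    -- turns it into an entry at q, and back.
    skip→entry : ∀ x → Flagged Skip x → Flagged Entry (exchange x) × exchange (exchange x) ≡ x
    skip→entry (L , p) (le , (p∈I , q , nx , q∉I) , not-descent) =
      let exchanged , le′ , nx′ , back = exchange-adjacent L le nx p⋢q (outside-not-below p∈I q∉I)
      in subst (λ y → Flagged Entry y × exchange y ≡ (L , p)) (sym exchanged) ((le′ , q∉I , p , nx′ , p∈I) , back)
      where
        p⋢q : ¬ p ⊏ q
        p⋢q p⊏q = not-descent (p∈I , q , nx , q∉I , Extension.adjacent-covers L le nx p⊏q)

    entry→skip : ∀ x → Flagged Entry x → Flagged Skip (exchange x) × exchange (exchange x) ≡ x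
    entry→skip (L , q) (le , q∉I , p , nx , p∈I) =
      let exchanged , le′ , nx′ , back = exchange-adjacent L le nx (outside-not-below p∈I q∉I) p⋢q
          not-descent : ¬ InDes po I (swap L q p) p
          not-descent = λ (_ , q′ , nx″ , _ , q′-covers) →
            p⋢q (subst (p ⊏_) (Extension.next-unique (swap L q p) le′ nx″ nx′) (proj₁ q′-covers))
      in subst (λ y → Flagged Skip y × exchange y ≡ (L , q)) (sym exchanged)
           ((le′ , (p∈I , q , nx′ , q∉I) , not-descent) , back)
      where
        p⋢q : ¬ p ⊏ q
        p⋢q = Extension.next-not-below L le nx

    module Family (Ls : List Ext) (uLs : Unique Ls) (mem : ∀ L → (L M.∈ Ls) ⇔ IsLE L) where

      flagged : ∀ {P : Ext → Fin n → Set} → (∀ L p → Dec (P L p)) → List (Ext × Fin n)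
      flagged P? = filter (uncurry P?) (cartesianProduct Ls (allFin n))

      flagged-unique : ∀ {P : Ext → Fin n → Set} (P? : ∀ L p → Dec (P L p)) → Unique (flagged P?)
      flagged-unique P? = filter⁺ (uncurry P?) (cartesianProduct⁺ uLs (allFin⁺ n))

      ∈-flagged : ∀ {P : Ext → Fin n → Set} (P? : ∀ L p → Dec (P L p)) x → (x M.∈ flagged P?) ⇔ Flagged P x
      ∈-flagged P? (L , p) = mk⇔
        (λ x∈ → let x∈flags , Pxp = ∈-filter⁻ (uncurry P?) x∈
                in Equivalence.to (mem L) (proj₁ (∈-cartesianProduct⁻ Ls (allFin n) x∈flags)) , Pxp)
        (λ (le , Pxp) → ∈-filter⁺ (uncurry P?) (∈-cartesianProduct⁺ (Equivalence.from (mem L) le) (∈-allFin p)) Pxp)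

      skips≡entries : sum (map (#_ ∘ skip?) Ls) ≡ sum (map (#_ ∘ entry?) Ls)
      skips≡entries = begin
        sum (map (#_ ∘ skip?) Ls)   ≡⟨ length-filter-product skip? Ls (allFin n) ⟨
        length (flagged skip?)      ≡⟨ length-≡-involution exchange _ _ (flagged-unique skip?) (flagged-unique entry?)
                                         (transfer {Skip} {Entry} skip? entry? skip→entry) (transfer {Entry} {Skip} entry? skip? entry→skip) ⟩
        length (flagged entry?)     ≡⟨ length-filter-product entry? Ls (allFin n) ⟩
        sum (map (#_ ∘ entry?) Ls)  ∎
        where
          transfer : ∀ {P Q : Ext → Fin n → Set} (P? : ∀ L p → Dec (P L p)) (Q? : ∀ L p → Dec (Q L p)) →
            (∀ x → Flagged P x → Flagged Q (exchange x) × exchange (exchange x) ≡ x) →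
            ∀ {x} → x M.∈ flagged P? → exchange x M.∈ flagged Q? × exchange (exchange x) ≡ x
          transfer {P} {Q} P? Q? step {x} x∈ =
            let Qx , back = step x (Equivalence.to (∈-flagged {P} P? x) x∈)
            in Equivalence.from (∈-flagged {Q} Q? (exchange x)) Qx , back

corollary5p8 : (n : ℕ) (_≼_ : Fin n → Fin n → Set)
    (po : IsDecPartialOrder _≡_ _≼_) →
    (∃ λ z → ∀ p → z ≼ p) →
    (∃ λ o → ∀ p → p ≼ o) →
    (I : Subset n) → IsOrderIdeal po I →
    (∃ λ p → p ∈ I) → (∃ λ p → p ∉ I) →
    (Ls : List (Vec (Fin n) n)) → Unique Ls →
    (∀ L → (L M.∈ Ls) ⇔ IsLinearExtension po L) →
    length Ls ≡ sum (map (desCount po I) Ls)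
corollary5p8 n _≼_ po min max I ideal nonempty proper Ls uLs mem =
  +-cancelˡ-≡ entries (length Ls) descents (begin
    entries + length Ls   ≡⟨ summed-balance ⟨
    descents + skips      ≡⟨ cong (descents +_) skips≡entries ⟩
    descents + entries    ≡⟨ +-comm descents entries ⟩
    entries + descents    ∎)
  where
    open LinearExtensions po
    open Ideal I ideal
    open Family Ls uLs mem

    descents skips entries : ℕ
    descents = sum (map (desCount po I) Ls)
    skips     = sum (map (#_ ∘ skip?) Ls)
    entries   = sum (map (#_ ∘ entry?) Ls)

    summed-balance : descents + skips ≡ entries + length Ls
    summed-balance = sum-map-balance (desCount po I) (#_ ∘ skip?) (#_ ∘ entry?) Ls
      λ L L∈ → Bounded.balance min max nonempty proper L (Equivalence.to (mem L) L∈)
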